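{- (i) For all $e\geq 0$ and all $n$ with $0\leq n\leq 2^e$, $$s(2^e+n)=s(2^e-n)+s(n),\qquad t(2^e+n)=(-1)^e\bigl(s(2^e-n)-s(n)\bigr).$$ (ii) For all $e\geq 0$ and all $n$ with $0\leq n\leq 2^{e+1}$, $$t(3\cdot 2^e+n)=t(6\cdot 2^e-n)=(-1)^e s(n).$$
   Context: The Stern sequence $s$ is defined by $s(0)=0$, $s(1)=1$, $s(2n)=s(n)$, $s(2n+1)=s(n)+s(n+1)$ for $n\geq1$. The twisted Stern sequence $t$ is defined by $t(0)=0$, $t(1)=1$, $t(2n)=-t(n)$, $t(2n+1)=-t(n)-t(n+1)$ for $n\geq 1$. -}

module Defs where

open import Data.Nat using (ℕ; zero; suc; _+_; _*_; _^_; _≤_; ⌊_/2⌋)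
open import Data.Nat.Base using (_%_)
open import Data.Integer using (ℤ; +_; -_) renaming (_+_ to _+ℤ_)

-- Fuel k suffices whenever n ≤ k (since ⌊n/2⌋+1 ≤ n for n ≥ 2),
-- so s n = sF n n gives the sequence defined by
--   s 0 = 0, s 1 = 1, s (2m) = s m, s (2m+1) = s m + s (m+1)  (m ≥ 1).
sF : ℕ → ℕ → ℕ
sF _ 0 = 0
sF _ 1 = 1
sF zero (suc (suc _)) = 0   -- unreachable with enough fuel
sF (suc k) n@(suc (suc _)) with n % 2
... | 0 = sF k ⌊ n /2⌋
... | _ = sF k ⌊ n /2⌋ + sF k (suc ⌊ n /2⌋)

s : ℕ → ℕ
s n = sF n n

-- twisted Stern: t 0 = 0, t 1 = 1, t (2m) = - t m, t (2m+1) = - t m - t (m+1)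
tF : ℕ → ℕ → ℤ
tF _ 0 = + 0
tF _ 1 = + 1
tF zero (suc (suc _)) = + 0  -- unreachable with enough fuel
tF (suc k) n@(suc (suc _)) with n % 2
... | 0 = - tF k ⌊ n /2⌋
... | _ = - (tF k ⌊ n /2⌋ +ℤ tF k (suc ⌊ n /2⌋))

t : ℕ → ℤ
t n = tF n n

sign : ℕ → ℤ
sign zero = + 1
sign (suc e) = - sign e

-- Everything follows from the splitting rule of (i), proved for all powers p of 2 at once
-- by doubling: if m + d = 2p then m and d have the same parity, and the recurrences reduce
-- s(2p + m) and t(2p + m) to values at p + ⌊m/2⌋ and p + ⌈m/2⌉, where the rule at p applies
-- (t(2n) = -t(n) flips the sign). Part (ii) needs no further induction: for n + r = 2p the
-- rule at 4p and then at 2p give t(4p + r) = ±(s(2p + n) - s(r)) = ±s(n), and t(6p - n) is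
-- such a value. For t(3p + n) use the rule at 2p when n ≤ p; otherwise 3p + n = 4p + k, and
-- the symmetry s(p + j) = s(p + k) of the rows of s (j + k = p) finishes.
module Submission where

open import Defs
open import Data.Nat using (ℕ; zero; suc; _+_; _*_; _∸_; _^_; _≤_; _<_; s≤s; ⌊_/2⌋; ⌈_/2⌉)
open import Data.Nat.Base using (_%_)
open import Data.Nat.Properties
open import Data.Nat.DivMod using (m*n%n≡0; [m+kn]%n≡m%n)
open import Data.Nat.Tactic.RingSolver as ℕ-Solver using ()
open import Data.Integer using (ℤ; +_; -_) renaming (_+_ to _+ℤ_; _*_ to _*ℤ_; _-_ to _-ℤ_)
open import Data.Integer.Properties using (pos-+; neg-involutive; neg-distribˡ-*)
open import Data.Integer.Tactic.RingSolver as ℤ-Solver using ()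
open import Data.Product using (_×_; _,_)
open import Data.Sum using (inj₁; inj₂)
open import Relation.Binary.PropositionalEquality
open ≡-Reasoning

2*m%2≡0 : ∀ m → 2 * m % 2 ≡ 0
2*m%2≡0 m = trans (cong (_% 2) (*-comm 2 m)) (m*n%n≡0 m 2)

[1+2*m]%2≡1 : ∀ m → (1 + 2 * m) % 2 ≡ 1
[1+2*m]%2≡1 m = trans (cong (λ x → (1 + x) % 2) (*-comm 2 m)) ([m+kn]%n≡m%n 1 m 2)

⌊2*m/2⌋≡m : ∀ m → ⌊ 2 * m /2⌋ ≡ m
⌊2*m/2⌋≡m m = sym (trans (n≡⌊n+n/2⌋ m) (cong (λ x → ⌊ m + x /2⌋) (sym (+-identityʳ m))))

⌊1+2*m/2⌋≡m : ∀ m → ⌊ 1 + 2 * m /2⌋ ≡ m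
⌊1+2*m/2⌋≡m m = sym (trans (n≡⌈n+n/2⌉ m) (cong (λ x → ⌈ m + x /2⌉) (sym (+-identityʳ m))))

⌊3+i/2⌋<k : ∀ {i k} → 2 + i ≤ k → ⌊ 3 + i /2⌋ < k
⌊3+i/2⌋<k {i} = ≤-trans (s≤s (⌊n/2⌋<n i))

sF-fuel : ∀ k k′ n → n ≤ k → n ≤ k′ → sF k n ≡ sF k′ n
sF-fuel _       _        0 _ _ = refl
sF-fuel _       _        1 _ _ = refl
sF-fuel (suc k) (suc k′) 2 _ _ = refl
sF-fuel (suc k) (suc k′) n@(suc (suc (suc i))) (s≤s n≤k) (s≤s n≤k′) with n % 2
... | 0     = sF-fuel k k′ ⌊ n /2⌋ (<⇒≤ (⌊3+i/2⌋<k n≤k)) (<⇒≤ (⌊3+i/2⌋<k n≤k′))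
... | suc _ = cong₂ _+_ (sF-fuel k k′ ⌊ n /2⌋ (<⇒≤ (⌊3+i/2⌋<k n≤k)) (<⇒≤ (⌊3+i/2⌋<k n≤k′)))
                        (sF-fuel k k′ (suc ⌊ n /2⌋) (⌊3+i/2⌋<k n≤k) (⌊3+i/2⌋<k n≤k′))

tF-fuel : ∀ k k′ n → n ≤ k → n ≤ k′ → tF k n ≡ tF k′ n
tF-fuel _       _        0 _ _ = refl
tF-fuel _       _        1 _ _ = refl
tF-fuel (suc k) (suc k′) 2 _ _ = refl
tF-fuel (suc k) (suc k′) n@(suc (suc (suc i))) (s≤s n≤k) (s≤s n≤k′) with n % 2
... | 0     = cong -_ (tF-fuel k k′ ⌊ n /2⌋ (<⇒≤ (⌊3+i/2⌋<k n≤k)) (<⇒≤ (⌊3+i/2⌋<k n≤k′)))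
... | suc _ = cong -_ (cong₂ _+ℤ_ (tF-fuel k k′ ⌊ n /2⌋ (<⇒≤ (⌊3+i/2⌋<k n≤k)) (<⇒≤ (⌊3+i/2⌋<k n≤k′)))
                                  (tF-fuel k k′ (suc ⌊ n /2⌋) (⌊3+i/2⌋<k n≤k) (⌊3+i/2⌋<k n≤k′)))

sF-enough : ∀ {k n} → n ≤ k → sF k n ≡ s n
sF-enough {k} {n} n≤k = sF-fuel k n n n≤k ≤-refl

tF-enough : ∀ {k n} → n ≤ k → tF k n ≡ t n
tF-enough {k} {n} n≤k = tF-fuel k n n n≤k ≤-refl

sF-unfold-even : ∀ k n → n % 2 ≡ 0 → sF (suc k) (2 + n) ≡ sF k (suc ⌊ n /2⌋)
sF-unfold-even k n n-even rewrite n-even = refl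

sF-unfold-odd : ∀ k n → n % 2 ≡ 1 → sF (suc k) (2 + n) ≡ sF k (suc ⌊ n /2⌋) + sF k (2 + ⌊ n /2⌋)
sF-unfold-odd k n n-odd rewrite n-odd = refl

tF-unfold-even : ∀ k n → n % 2 ≡ 0 → tF (suc k) (2 + n) ≡ - tF k (suc ⌊ n /2⌋)
tF-unfold-even k n n-even rewrite n-even = refl

tF-unfold-odd : ∀ k n → n % 2 ≡ 1 → tF (suc k) (2 + n) ≡ - (tF k (suc ⌊ n /2⌋) +ℤ tF k (2 + ⌊ n /2⌋))
tF-unfold-odd k n n-odd rewrite n-odd = refl

m≤2*m : ∀ m → m ≤ 2 * m
m≤2*m m = m≤n*m m 2

s-even : ∀ m → s (2 * m) ≡ s m
s-even zero    = refl
s-even (suc m) = begin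
  s (2 * suc m)                       ≡⟨ cong s (*-suc 2 m) ⟩
  sF (2 + 2 * m) (2 + 2 * m)          ≡⟨ sF-unfold-even _ (2 * m) (2*m%2≡0 m) ⟩
  sF (1 + 2 * m) (suc ⌊ 2 * m /2⌋)    ≡⟨ cong (λ x → sF (1 + 2 * m) (suc x)) (⌊2*m/2⌋≡m m) ⟩
  sF (1 + 2 * m) (suc m)              ≡⟨ sF-enough (s≤s (m≤2*m m)) ⟩
  s (suc m)                           ∎

s-odd : ∀ m → s (1 + 2 * m) ≡ s m + s (1 + m)
s-odd zero    = refl
s-odd (suc m) = begin
  s (1 + 2 * suc m)                                       ≡⟨ cong (λ x → s (suc x)) (*-suc 2 m) ⟩
  sF (3 + 2 * m) (3 + 2 * m)                              ≡⟨ sF-unfold-odd _ (1 + 2 * m) ([1+2*m]%2≡1 m) ⟩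
  sF k (suc ⌊ 1 + 2 * m /2⌋) + sF k (2 + ⌊ 1 + 2 * m /2⌋) ≡⟨ cong (λ x → sF k (suc x) + sF k (2 + x)) (⌊1+2*m/2⌋≡m m) ⟩
  sF k (1 + m) + sF k (2 + m)                             ≡⟨ cong₂ _+_ (sF-enough (m≤n⇒m≤1+n (s≤s (m≤2*m m))))
                                                                       (sF-enough (s≤s (s≤s (m≤2*m m)))) ⟩
  s (suc m) + s (2 + m)                                   ∎
  where k = 2 + 2 * m

t-even : ∀ m → t (2 * m) ≡ - t m
t-even zero    = refl
t-even (suc m) = begin
  t (2 * suc m)                       ≡⟨ cong t (*-suc 2 m) ⟩
  tF (2 + 2 * m) (2 + 2 * m)          ≡⟨ tF-unfold-even _ (2 * m) (2*m%2≡0 m) ⟩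
  - tF (1 + 2 * m) (suc ⌊ 2 * m /2⌋)  ≡⟨ cong (λ x → - tF (1 + 2 * m) (suc x)) (⌊2*m/2⌋≡m m) ⟩
  - tF (1 + 2 * m) (suc m)            ≡⟨ cong -_ (tF-enough (s≤s (m≤2*m m))) ⟩
  - t (suc m)                         ∎

-- Unlike s, the odd recurrence of t fails at m = 0: t 1 = 1, not - (t 0 + t 1).
t-odd : ∀ m → t (1 + 2 * suc m) ≡ - (t (suc m) +ℤ t (2 + m))
t-odd m = begin
  t (1 + 2 * suc m)                                            ≡⟨ cong (λ x → t (suc x)) (*-suc 2 m) ⟩
  tF (3 + 2 * m) (3 + 2 * m)                                   ≡⟨ tF-unfold-odd _ (1 + 2 * m) ([1+2*m]%2≡1 m) ⟩
  - (tF k (suc ⌊ 1 + 2 * m /2⌋) +ℤ tF k (2 + ⌊ 1 + 2 * m /2⌋)) ≡⟨ cong (λ x → - (tF k (suc x) +ℤ tF k (2 + x))) (⌊1+2*m/2⌋≡m m) ⟩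
  - (tF k (1 + m) +ℤ tF k (2 + m))                             ≡⟨ cong -_ (cong₂ _+ℤ_ (tF-enough (m≤n⇒m≤1+n (s≤s (m≤2*m m))))
                                                                                    (tF-enough (s≤s (s≤s (m≤2*m m))))) ⟩
  - (t (suc m) +ℤ t (2 + m))                                   ∎
  where k = 2 + 2 * m

data Halves (p : ℕ) : ℕ → ℕ → Set where
  even : ∀ a b → a + b ≡ p → Halves p (2 * a) (2 * b)
  odd  : ∀ a b → suc (a + b) ≡ p → Halves p (1 + 2 * a) (1 + 2 * b)

halves : ∀ p m d → m + d ≡ 2 * p → Halves p m d
halves p       0                d refl = even 0 p refl
halves zero    (suc m)          d ()
halves (suc p) 1                d eq with suc-injective (trans eq (*-suc 2 p))
... | refl = odd 0 p refl
halves (suc p) (suc (suc m)) d eq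
  with halves p m d (suc-injective (suc-injective (trans eq (*-suc 2 p))))
... | even a b a+b = subst (λ x → Halves (suc p) x (2 * b)) (*-suc 2 a) (even (suc a) b (cong suc a+b))
... | odd  a b a+b = subst (λ x → Halves (suc p) x (1 + 2 * b)) (cong suc (*-suc 2 a)) (odd (suc a) b (cong suc a+b))

-- The rule of (i) at p, with p − m written as d to avoid truncated subtraction.
SternSplitsAt : ℕ → Set
SternSplitsAt p = ∀ {m d} → m + d ≡ p → s (p + m) ≡ s d + s m

TwistedSplitsAt : ℕ → ℤ → Set
TwistedSplitsAt p g = ∀ {m d} → m + d ≡ p → t (p + m) ≡ g *ℤ (+ s d -ℤ + s m)

2p+[1+2a]≡1+2[p+a] : ∀ p a → 2 * p + (1 + 2 * a) ≡ 1 + 2 * (p + a)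
2p+[1+2a]≡1+2[p+a] = ℕ-Solver.solve-∀

stern-splits-double : ∀ {p} → SternSplitsAt p → SternSplitsAt (2 * p)
stern-splits-double {p} splits {m} {d} m+d with halves p m d m+d
... | even a b refl = begin
  s (2 * p + 2 * a)        ≡⟨ cong s (*-distribˡ-+ 2 p a) ⟨
  s (2 * (p + a))          ≡⟨ s-even (p + a) ⟩
  s (p + a)                ≡⟨ splits refl ⟩
  s b + s a                ≡⟨ cong₂ _+_ (s-even b) (s-even a) ⟨
  s (2 * b) + s (2 * a)    ∎
... | odd a b refl = begin
  s (2 * p + (1 + 2 * a))                 ≡⟨ cong s (2p+[1+2a]≡1+2[p+a] p a) ⟩
  s (1 + 2 * (p + a))                     ≡⟨ s-odd (p + a) ⟩
  s (p + a) + s (suc (p + a))             ≡⟨ cong (λ x → s (p + a) + s x) (+-suc p a) ⟨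
  s (p + a) + s (p + suc a)               ≡⟨ cong₂ _+_ (splits (+-suc a b)) (splits refl) ⟩
  (s (suc b) + s a) + (s b + s (suc a))   ≡⟨ interchange (s (suc b)) (s a) (s b) (s (suc a)) ⟩
  (s b + s (suc b)) + (s a + s (suc a))   ≡⟨ cong₂ _+_ (s-odd b) (s-odd a) ⟨
  s (1 + 2 * b) + s (1 + 2 * a)           ∎
  where
  interchange : ∀ w x y z → (w + x) + (y + z) ≡ (y + w) + (x + z)
  interchange = ℕ-Solver.solve-∀

twisted-splits-double : ∀ {p g} → TwistedSplitsAt p g → TwistedSplitsAt (2 * p) (- g)
twisted-splits-double {p} {g} splits {m} {d} m+d with halves p m d m+d
... | even a b refl = begin
  t (2 * p + 2 * a)                          ≡⟨ cong t (*-distribˡ-+ 2 p a) ⟨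
  t (2 * (p + a))                            ≡⟨ t-even (p + a) ⟩
  - t (p + a)                                ≡⟨ cong -_ (splits refl) ⟩
  - (g *ℤ (+ s b -ℤ + s a))                  ≡⟨ neg-distribˡ-* g _ ⟩
  (- g) *ℤ (+ s b -ℤ + s a)                  ≡⟨ cong₂ (λ x y → (- g) *ℤ (+ x -ℤ + y)) (s-even b) (s-even a) ⟨
  (- g) *ℤ (+ s (2 * b) -ℤ + s (2 * a))      ∎
... | odd a b refl = begin
  t (2 * p + (1 + 2 * a))                                          ≡⟨ cong t (2p+[1+2a]≡1+2[p+a] p a) ⟩
  t (1 + 2 * (p + a))                                              ≡⟨ t-odd (a + b + a) ⟩
  - (t (p + a) +ℤ t (suc (p + a)))                                 ≡⟨ cong (λ x → - (t (p + a) +ℤ t x)) (+-suc p a) ⟨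
  - (t (p + a) +ℤ t (p + suc a))                                   ≡⟨ cong₂ (λ x y → - (x +ℤ y)) (splits (+-suc a b)) (splits refl) ⟩
  - (g *ℤ (+ s (suc b) -ℤ + s a) +ℤ g *ℤ (+ s b -ℤ + s (suc a)))   ≡⟨ regroup g (+ s b) (+ s (suc b)) (+ s a) (+ s (suc a)) ⟩
  (- g) *ℤ ((+ s b +ℤ + s (suc b)) -ℤ (+ s a +ℤ + s (suc a)))      ≡⟨ cong₂ (λ x y → (- g) *ℤ (x -ℤ y)) (pos-+ (s b) _) (pos-+ (s a) _) ⟨
  (- g) *ℤ (+ (s b + s (suc b)) -ℤ + (s a + s (suc a)))            ≡⟨ cong₂ (λ x y → (- g) *ℤ (+ x -ℤ + y)) (s-odd b) (s-odd a) ⟨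
  (- g) *ℤ (+ s (1 + 2 * b) -ℤ + s (1 + 2 * a))                    ∎
  where
  regroup : ∀ g x x′ y y′ → - (g *ℤ (x′ -ℤ y) +ℤ g *ℤ (x -ℤ y′)) ≡ (- g) *ℤ ((x +ℤ x′) -ℤ (y +ℤ y′))
  regroup = ℤ-Solver.solve-∀

stern-splits-pow : ∀ e → SternSplitsAt (2 ^ e)
stern-splits-pow zero {0}           refl = refl
stern-splits-pow zero {1}           refl = refl
stern-splits-pow zero {suc (suc _)} ()
stern-splits-pow (suc e) = stern-splits-double (stern-splits-pow e)

twisted-splits-pow : ∀ e → TwistedSplitsAt (2 ^ e) (sign e)
twisted-splits-pow zero {0}           refl = refl
twisted-splits-pow zero {1}           refl = refl
twisted-splits-pow zero {suc (suc _)} ()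
twisted-splits-pow (suc e) = twisted-splits-double {g = sign e} (twisted-splits-pow e)

stern-row-symmetric : ∀ {q j k} → SternSplitsAt q → j + k ≡ q → s (q + j) ≡ s (q + k)
stern-row-symmetric {q} {j} {k} splits j+k = begin
  s (q + j)  ≡⟨ splits j+k ⟩
  s k + s j  ≡⟨ +-comm (s k) (s j) ⟩
  s j + s k  ≡⟨ splits (trans (+-comm k j) j+k) ⟨
  s (q + k)  ∎

+[x+y]-+x≡+y : ∀ x y → + (x + y) -ℤ + x ≡ + y
+[x+y]-+x≡+y x y = trans (cong (_-ℤ + x) (pos-+ x y)) (cancel (+ x) (+ y))
  where
  cancel : ∀ x y → (x +ℤ y) -ℤ x ≡ y
  cancel = ℤ-Solver.solve-∀

twisted-2q+r : ∀ {q g n r} → SternSplitsAt q → TwistedSplitsAt (2 * q) g → n + r ≡ q →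
               t (2 * q + r) ≡ g *ℤ + s n
twisted-2q+r {g = g} {n} {r} s-splits t-splits refl = begin
  t (2 * q + r)                      ≡⟨ t-splits (arith n r) ⟩
  g *ℤ (+ s (q + n) -ℤ + s r)        ≡⟨ cong (λ x → g *ℤ (+ x -ℤ + s r)) (s-splits refl) ⟩
  g *ℤ (+ (s r + s n) -ℤ + s r)      ≡⟨ cong (g *ℤ_) (+[x+y]-+x≡+y (s r) (s n)) ⟩
  g *ℤ + s n                         ∎
  where
  q = n + r
  arith : ∀ n r → r + ((n + r) + n) ≡ 2 * (n + r)
  arith = ℕ-Solver.solve-∀

twisted-3q+n-low : ∀ {q g n k} → SternSplitsAt q → TwistedSplitsAt (2 * q) g → n + k ≡ q →
                   t (3 * q + n) ≡ (- g) *ℤ + s n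
twisted-3q+n-low {g = g} {n} {k} s-splits t-splits refl = begin
  t (3 * q + n)                         ≡⟨ cong t (arith₁ n k) ⟩
  t (2 * q + (q + n))                   ≡⟨ t-splits (arith₂ n k) ⟩
  g *ℤ (+ s k -ℤ + s (q + n))           ≡⟨ cong (λ x → g *ℤ (+ s k -ℤ + x)) (s-splits refl) ⟩
  g *ℤ (+ s k -ℤ + (s k + s n))         ≡⟨ cong (λ x → g *ℤ (+ s k -ℤ x)) (pos-+ (s k) (s n)) ⟩
  g *ℤ (+ s k -ℤ (+ s k +ℤ + s n))      ≡⟨ flip-sign g (+ s k) (+ s n) ⟩
  (- g) *ℤ + s n                        ∎
  where
  q = n + k
  arith₁ : ∀ n k → 3 * (n + k) + n ≡ 2 * (n + k) + ((n + k) + n)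
  arith₁ = ℕ-Solver.solve-∀
  arith₂ : ∀ n k → ((n + k) + n) + k ≡ 2 * (n + k)
  arith₂ = ℕ-Solver.solve-∀
  flip-sign : ∀ g x y → g *ℤ (x -ℤ (x +ℤ y)) ≡ (- g) *ℤ y
  flip-sign = ℤ-Solver.solve-∀

twisted-3q+n-high : ∀ {q g k j} → SternSplitsAt q → SternSplitsAt (2 * q) → TwistedSplitsAt (2 * (2 * q)) g →
                    k + j ≡ q → t (3 * q + (q + k)) ≡ g *ℤ + s (q + k)
twisted-3q+n-high {g = g} {k} {j} s-splits s-splits₂ t-splits refl = begin
  t (3 * q + (q + k))          ≡⟨ cong t (arith₁ k j) ⟩
  t (2 * (2 * q) + k)          ≡⟨ twisted-2q+r {g = g} s-splits₂ t-splits (arith₂ k j) ⟩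
  g *ℤ + s (q + j)             ≡⟨ cong (λ x → g *ℤ + x) (stern-row-symmetric s-splits (+-comm j k)) ⟩
  g *ℤ + s (q + k)             ∎
  where
  q = k + j
  arith₁ : ∀ k j → 3 * (k + j) + ((k + j) + k) ≡ 2 * (2 * (k + j)) + k
  arith₁ = ℕ-Solver.solve-∀
  arith₂ : ∀ k j → ((k + j) + j) + k ≡ 2 * (k + j)
  arith₂ = ℕ-Solver.solve-∀

3q∸n≡2q+r : ∀ {q n r} → n + r ≡ q → 3 * q ∸ n ≡ 2 * q + r
3q∸n≡2q+r {n = n} {r} refl = trans (cong (_∸ n) (arith n r)) (m+n∸m≡n n (2 * (n + r) + r))
  where
  arith : ∀ n r → 3 * (n + r) ≡ n + (2 * (n + r) + r)
  arith = ℕ-Solver.solve-∀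

twisted-splits-pow-2+ : ∀ e → TwistedSplitsAt (2 ^ (2 + e)) (sign e)
twisted-splits-pow-2+ e = subst (TwistedSplitsAt (2 ^ (2 + e))) (neg-involutive (sign e)) (twisted-splits-pow (2 + e))

p+k≤2*p⇒k≤p : ∀ p {k} → p + k ≤ 2 * p → k ≤ p
p+k≤2*p⇒k≤p p {k} p+k≤2p = ≤-trans (+-cancelˡ-≤ p k (p + 0) p+k≤2p) (≤-reflexive (+-identityʳ p))

twisted-6·2^e∸n : ∀ e {n} → n ≤ 2 * 2 ^ e → t (6 * 2 ^ e ∸ n) ≡ sign e *ℤ + s n
twisted-6·2^e∸n e {n} n≤2p with m≤n⇒∃[o]m+o≡n n≤2p
... | r , n+r = begin
  t (6 * 2 ^ e ∸ n)          ≡⟨ cong (λ x → t (x ∸ n)) (*-assoc 3 2 (2 ^ e)) ⟩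
  t (3 * (2 * 2 ^ e) ∸ n)    ≡⟨ cong t (3q∸n≡2q+r n+r) ⟩
  t (2 * (2 * 2 ^ e) + r)    ≡⟨ twisted-2q+r {g = sign e} (stern-splits-pow (1 + e)) (twisted-splits-pow-2+ e) n+r ⟩
  sign e *ℤ + s n            ∎

twisted-3·2^e+n : ∀ e {n} → n ≤ 2 * 2 ^ e → t (3 * 2 ^ e + n) ≡ sign e *ℤ + s n
twisted-3·2^e+n e {n} n≤2p with ≤-total n (2 ^ e)
... | inj₁ n≤p with m≤n⇒∃[o]m+o≡n n≤p
...   | k , n+k = trans (twisted-3q+n-low {g = sign (1 + e)} (stern-splits-pow e) (twisted-splits-pow (1 + e)) n+k)
                        (cong (_*ℤ + s n) (neg-involutive (sign e)))
twisted-3·2^e+n e {n} n≤2p | inj₂ p≤n with m≤n⇒∃[o]m+o≡n p≤n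
... | k , refl with m≤n⇒∃[o]m+o≡n (p+k≤2*p⇒k≤p (2 ^ e) n≤2p)
...   | j , k+j = twisted-3q+n-high {g = sign e} (stern-splits-pow e) (stern-splits-pow (1 + e)) (twisted-splits-pow-2+ e) k+j

mainTheorem2 :
    ((e n : ℕ) → n ≤ 2 ^ e →
      (s (2 ^ e + n) ≡ s (2 ^ e ∸ n) + s n)
      × (t (2 ^ e + n) ≡ sign e *ℤ (+ s (2 ^ e ∸ n) -ℤ + s n)))
    × ((e n : ℕ) → n ≤ 2 ^ (e + 1) →
      (t (3 * 2 ^ e + n) ≡ t (6 * 2 ^ e ∸ n))
      × (t (6 * 2 ^ e ∸ n) ≡ sign e *ℤ + s n))
mainTheorem2 =
    (λ e n n≤p → let n+d = m+[n∸m]≡n n≤p in stern-splits-pow e n+d , twisted-splits-pow e n+d)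
  , (λ e n n≤2p → let n≤2p′ = subst (λ x → n ≤ 2 ^ x) (+-comm e 1) n≤2p in
       trans (twisted-3·2^e+n e n≤2p′) (sym (twisted-6·2^e∸n e n≤2p′)) , twisted-6·2^e∸n e n≤2p′)
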